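{- Let $F$ be a positive disjunctive MBN on vertex set $V=\{1,\dots,n\}$, i.e. each local function is $f_i(x)=\bigvee_{j:(j,i)\in E}x_j$ (a disjunction of one or more non-negated variables), whose interaction graph $G=(V,E)$ is strongly connected. If at least one vertex $v$ has delay $dt_v\ge2$, then $F$ has no limit cycle, and its only attractors are the two fixed points $(0,\dots,0)$ and $(dt_1,\dots,dt_n)$.
   Context: An MBN on $\{1,\dots,n\}$ is given by Boolean functions $f_i:\{0,1\}^n\to\{0,1\}$ and a delay vector $dt=(dt_1,\dots,dt_n)$ of positive integers. Its configurations are vectors $\Delta=(\Delta_1,\dots,\Delta_n)$ with $\Delta_i\in\{0,\dots,dt_i\}$; the underlying Boolean state is $x(\Delta)$ with $x_i=1$ iff $\Delta_i\ge1$. The dynamics is $\Delta\mapsto\Delta'$ with $\Delta'_i=dt_i$ if $f_i(x(\Delta))=1$; $\Delta'_i=\Delta_i-1$ if $f_i(x(\Delta))=0$ and $\Delta_i>0$; $\Delta'_i=0$ otherwise. Any configuration may be initial. Attractors are periodic orbits: fixed points (length 1) and limit cycles (length $\ge2$). The interaction graph has an arc $(j,i)$ iff $x_j$ appears in $f_i$. -}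

module Defs where

open import Data.Nat using (ℕ; zero; suc; _≤_)
open import Data.Product using (Σ; _×_)
open import Data.Bool using (Bool; true; false; _∧_)
open import Data.Fin using (Fin)
open import Data.List using (allFin)
open import Data.Bool.ListAction using (any)
open import Relation.Binary.PropositionalEquality using (_≡_)
open import Relation.Binary.Construct.Closure.ReflexiveTransitive using (Star)

-- An arc set on vertices Fin n: E j i ≡ true  iff  (j , i) is an arc.
Graph : ℕ → Set
Graph n = Fin n → Fin n → Bool

Arc : ∀ {n} → Graph n → Fin n → Fin n → Set
Arc E j i = E j i ≡ true

StronglyConnected : ∀ {n} → Graph n → Set
StronglyConnected {n} E = (i j : Fin n) → Star (Arc E) i j

-- MBN configuration: Δ i ∈ {0,…,dt i} (the bound is a separate hypothesis)
Config : ℕ → Set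
Config n = Fin n → ℕ

-- Boolean state x(Δ): x_i = 1 iff Δ_i ≥ 1
isPos : ℕ → Bool
isPos zero    = false
isPos (suc _) = true

disj : ∀ {n} → Graph n → Config n → Fin n → Bool
disj {n} E Δ i = any (λ j → E j i ∧ isPos (Δ j)) (allFin n)

stepVal : Bool → ℕ → ℕ → ℕ
stepVal true  d _       = d
stepVal false d zero    = zero
stepVal false d (suc k) = k

step : ∀ {n} → Graph n → (dt : Fin n → ℕ) → Config n → Config n
step E dt Δ i = stepVal (disj E Δ i) (dt i) (Δ i)

iterate : ∀ {n} → Graph n → (dt : Fin n → ℕ) → ℕ → Config n → Config n
iterate E dt zero    Δ = Δ
iterate E dt (suc p) Δ = step E dt (iterate E dt p Δ)

Valid : ∀ {n} → (dt : Fin n → ℕ) → Config n → Set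
Valid dt Δ = ∀ i → Δ i ≤ dt i

Periodic : ∀ {n} → Graph n → (dt : Fin n → ℕ) → Config n → Set
Periodic E dt Δ = Σ ℕ (λ p → Σ ℕ (λ q → p ≡ suc q) × (∀ i → iterate E dt p Δ i ≡ Δ i))

FixedPoint : ∀ {n} → Graph n → (dt : Fin n → ℕ) → Config n → Set
FixedPoint E dt Δ = ∀ i → step E dt Δ i ≡ Δ i

{-# OPTIONS --safe #-}
-- Once some vertex is positive, positivity spreads along arcs one step per time unit, since
-- a positive in-neighbour resets a vertex to its full delay.  At a vertex v with dt v ≥ 2 a
-- reset keeps v positive for one further step, so each trip of positivity around a cycle
-- through v lengthens the run of consecutive positive times at v by one.  A run longer
-- than every path from v makes all vertices positive simultaneously; one step later the
-- configuration is dt, which is fixed.  A periodic configuration recurs at arbitrarily late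
-- times, hence it is dt unless no vertex is positive at all, i.e. unless it is 0.
module Submission where

open import Defs
open import Data.Nat using (ℕ; zero; suc; _≤_; _≥_; _+_; _*_; _∸_; z≤n; s≤s)
open import Data.Nat.Properties using (≤-refl; +-suc; +-assoc; +-comm; *-comm; m∸n≤m; m∸n+n≡m; m≤n⇒m<n∨m≡n)
open import Data.Fin using (Fin)
open import Data.Fin.Properties using (any?)
open import Data.Product using (Σ; _×_; _,_; proj₁; proj₂)
open import Data.Sum using (_⊎_; inj₁; inj₂)
open import Data.Bool using (Bool; true; false; _∧_)
open import Data.Bool.Properties using (T-≡; ∧-zeroʳ) renaming (_≟_ to _≟ᴮ_)
open import Data.Bool.ListAction using (any; or)
open import Data.List using (List; []; _∷_; map; allFin)
open import Data.List.Properties using (map-cong)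
open import Data.List.Relation.Unary.Any as Any using ()
open import Data.List.Relation.Unary.Any.Properties using (any⁺)
open import Data.List.Relation.Unary.All as All using ()
open import Data.List.Relation.Unary.All.Properties using (map⁻)
open import Data.List.Membership.Propositional.Properties using (∈-allFin)
open import Data.List.Extrema.Nat using (max; xs≤max)
open import Data.Empty using (⊥-elim)
open import Function using (_∘_; Equivalence)
open import Relation.Nullary using (yes; no)
open import Relation.Binary.PropositionalEquality
  using (_≡_; _≢_; _≗_; refl; sym; trans; cong; cong₂; subst; module ≡-Reasoning)
open import Relation.Binary.Construct.Closure.ReflexiveTransitive using (Star; ε; _◅_)

length : ∀ {A : Set} {R : A → A → Set} {i j} → Star R i j → ℕ
length ε        = 0
length (_ ◅ rs) = suc (length rs)

any-false : ∀ {A : Set} (f : A → Bool) (xs : List A) → (∀ x → f x ≡ false) → any f xs ≡ false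
any-false f []       _       = refl
any-false f (x ∷ xs) f≡false rewrite f≡false x = any-false f xs f≡false

1≤⇒isPos : ∀ {x} → 1 ≤ x → isPos x ≡ true
1≤⇒isPos (s≤s _) = refl

isPos≢true⇒≡0 : ∀ {x} → isPos x ≢ true → x ≡ 0
isPos≢true⇒≡0 {zero}  _     = refl
isPos≢true⇒≡0 {suc _} ¬true = ⊥-elim (¬true refl)

stepVal-self-positive : ∀ b {d} → 2 ≤ d → isPos (stepVal b d d) ≡ true
stepVal-self-positive true  (s≤s (s≤s _)) = refl
stepVal-self-positive false (s≤s (s≤s _)) = refl

module _ {n : ℕ} (E : Graph n) where

  disj-arc : ∀ (Δ : Config n) {j i} → Arc E j i → isPos (Δ j) ≡ true → disj E Δ i ≡ true
  disj-arc Δ {j} arc positive = Equivalence.to T-≡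
    (any⁺ _ (Any.map (λ { refl → Equivalence.from T-≡ (cong₂ _∧_ arc positive) }) (∈-allFin j)))

  disj-zero : ∀ i → disj E (λ _ → 0) i ≡ false
  disj-zero i = any-false _ (allFin n) (λ j → ∧-zeroʳ (E j i))

  disj-cong : ∀ {Δ Δ′ : Config n} → Δ ≗ Δ′ → ∀ i → disj E Δ i ≡ disj E Δ′ i
  disj-cong Δ≗Δ′ i = cong or (map-cong (λ j → cong (λ x → E j i ∧ isPos x) (Δ≗Δ′ j)) (allFin n))

module _ {n : ℕ} (E : Graph n) (dt : Fin n → ℕ) where

  step-cong : ∀ {Δ Δ′ : Config n} → Δ ≗ Δ′ → step E dt Δ ≗ step E dt Δ′
  step-cong Δ≗Δ′ i = cong₂ (λ b x → stepVal b (dt i) x) (disj-cong E Δ≗Δ′ i) (Δ≗Δ′ i)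

  iterate-cong : ∀ k {Δ Δ′ : Config n} → Δ ≗ Δ′ → iterate E dt k Δ ≗ iterate E dt k Δ′
  iterate-cong zero    Δ≗Δ′ = Δ≗Δ′
  iterate-cong (suc k) Δ≗Δ′ = step-cong (iterate-cong k Δ≗Δ′)

  iterate-+ : ∀ a b (Δ : Config n) → iterate E dt (a + b) Δ ≡ iterate E dt a (iterate E dt b Δ)
  iterate-+ zero    b Δ = refl
  iterate-+ (suc a) b Δ = cong (step E dt) (iterate-+ a b Δ)

  iterate-* : ∀ p {Δ : Config n} → iterate E dt p Δ ≗ Δ → ∀ m → iterate E dt (m * p) Δ ≗ Δ
  iterate-* p period zero    i = refl
  iterate-* p {Δ} period (suc m) i = begin
    iterate E dt (p + m * p) Δ i                ≡⟨ cong (λ Δ′ → Δ′ i) (iterate-+ p (m * p) Δ) ⟩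
    iterate E dt p (iterate E dt (m * p) Δ) i   ≡⟨ iterate-cong p (iterate-* p period m) i ⟩
    iterate E dt p Δ i                          ≡⟨ period i ⟩
    Δ i                                         ∎
    where open ≡-Reasoning

  module Spreading (dt≥1 : ∀ i → 1 ≤ dt i) (Δ : Config n) where

    Positive : ℕ → Fin n → Set
    Positive t i = isPos (iterate E dt t Δ i) ≡ true

    reset⇒positive : ∀ t {i} → iterate E dt t Δ i ≡ dt i → Positive t i
    reset⇒positive t {i} reset rewrite reset = 1≤⇒isPos (dt≥1 i)

    reset-by-arc : ∀ t {j i} → Positive t j → Arc E j i → iterate E dt (suc t) Δ i ≡ dt i
    reset-by-arc t pos arc rewrite disj-arc E (iterate E dt t Δ) arc pos = refl

    positive-arc : ∀ t {j i} → Positive t j → Arc E j i → Positive (suc t) i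
    positive-arc t pos arc = reset⇒positive (suc t) (reset-by-arc t pos arc)

    reset-lingers : ∀ t {v} → iterate E dt t Δ v ≡ dt v → 2 ≤ dt v → Positive (suc t) v
    reset-lingers t {v} reset dt≥2 rewrite reset =
      stepVal-self-positive (disj E (iterate E dt t Δ) v) dt≥2

    PositiveDuring : ℕ → ℕ → Fin n → Set
    PositiveDuring t k i = ∀ s → s ≤ k → Positive (s + t) i

    positive⇒during-0 : ∀ t {i} → Positive t i → PositiveDuring t 0 i
    positive⇒during-0 t pos zero z≤n = pos

    during-arc : ∀ t {k j i} → PositiveDuring t k j → Arc E j i → PositiveDuring (suc t) k i
    during-arc t run arc s s≤k rewrite +-suc s t = positive-arc (s + t) (run s s≤k) arc

    during-path : ∀ t {k i j} → PositiveDuring t k i → (path : Star (Arc E) i j)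
                → PositiveDuring (length path + t) k j
    during-path t run ε = run
    during-path t {k} {j = j} run (arc ◅ path) =
      subst (λ t′ → PositiveDuring t′ k j) (+-suc (length path) t)
        (during-path (suc t) (during-arc t run arc) path)

    during-arc-lingers : ∀ t {k w v} → PositiveDuring t k w → Arc E w v → 2 ≤ dt v
                       → PositiveDuring (suc t) (suc k) v
    during-arc-lingers t run arc dt≥2 s s≤1+k with m≤n⇒m<n∨m≡n s≤1+k
    ... | inj₁ (s≤s s≤k) = during-arc t run arc s s≤k
    during-arc-lingers t {k} {v = v} run arc dt≥2 _ _ | inj₂ refl =
      subst (λ t′ → Positive (suc t′) v) (sym (+-suc k t))
        (reset-lingers (suc (k + t)) (reset-by-arc (k + t) (run k ≤-refl) arc) dt≥2)

    arbitrarily-long-runs : ∀ {v w} → Star (Arc E) v w → Arc E w v → 2 ≤ dt v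
                          → ∀ t → Positive t v → ∀ m → Σ ℕ λ t′ → PositiveDuring t′ m v
    arbitrarily-long-runs _ _ _ t pos zero = t , positive⇒during-0 t pos
    arbitrarily-long-runs cycle arc dt≥2 t pos (suc m) with arbitrarily-long-runs cycle arc dt≥2 t pos m
    ... | t′ , run = suc (length cycle + t′) ,
                     during-arc-lingers (length cycle + t′) (during-path t′ run cycle) arc dt≥2

    eventually-all-positive : StronglyConnected E → ∀ {u v w} → Arc E w v → 2 ≤ dt v → Positive 0 u
                            → Σ ℕ λ T → ∀ j → Positive T j
    eventually-all-positive strong {u} {v} {w} arc dt≥2 pos₀ = L + t , all-positive
      where
      ℓ : Fin n → ℕ
      ℓ j = length (strong v j)

      L : ℕ
      L = max 0 (map ℓ (allFin n))

      ℓ≤L : ∀ j → ℓ j ≤ L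
      ℓ≤L j = All.lookup (map⁻ (xs≤max 0 (map ℓ (allFin n)))) (∈-allFin j)

      positive-at-v : Positive (length (strong u v) + 0) v
      positive-at-v = during-path 0 (positive⇒during-0 0 pos₀) (strong u v) 0 z≤n

      long-run : Σ ℕ λ t → PositiveDuring t L v
      long-run = arbitrarily-long-runs (strong v w) arc dt≥2 (length (strong u v) + 0) positive-at-v L

      t : ℕ
      t = proj₁ long-run

      all-positive : ∀ j → Positive (L + t) j
      all-positive j = subst (λ t′ → Positive t′ j) arrival
        (during-path t (proj₂ long-run) (strong v j) (L ∸ ℓ j) (m∸n≤m L (ℓ j)))
        where
        arrival : L ∸ ℓ j + (ℓ j + t) ≡ L + t
        arrival = trans (sym (+-assoc (L ∸ ℓ j) (ℓ j) t)) (cong (_+ t) (m∸n+n≡m (ℓ≤L j)))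

    module _ (has-in-neighbour : ∀ i → Σ (Fin n) λ j → Arc E j i) where

      all-positive⇒reset : ∀ t → (∀ j → Positive t j) → ∀ i → iterate E dt (suc t) Δ i ≡ dt i
      all-positive⇒reset t all-positive i =
        reset-by-arc t (all-positive (proj₁ (has-in-neighbour i))) (proj₂ (has-in-neighbour i))

      stays-reset : ∀ t → (∀ j → Positive t j) → ∀ r i → iterate E dt (r + suc t) Δ i ≡ dt i
      stays-reset t all-positive zero = all-positive⇒reset t all-positive
      stays-reset t all-positive (suc r) = all-positive⇒reset (r + suc t)
        (λ j → reset⇒positive (r + suc t) (stays-reset t all-positive r j))

proposition1 : (n : ℕ) (E : Graph n) (dt : Fin n → ℕ)
    → (∀ i → 1 ≤ dt i)
    → (∀ i → Σ (Fin n) (λ j → Arc E j i))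
    → StronglyConnected E
    → Σ (Fin n) (λ v → dt v ≥ 2)
    → FixedPoint E dt (λ _ → 0)
      × FixedPoint E dt dt
      × ((Δ : Config n) → Valid dt Δ → Periodic E dt Δ
          → (∀ i → Δ i ≡ 0) ⊎ (∀ i → Δ i ≡ dt i))
proposition1 n E dt dt≥1 has-in-neighbour strong (v , dt≥2) = zero-fixed , dt-fixed , attractor
  where
  zero-fixed : FixedPoint E dt (λ _ → 0)
  zero-fixed i rewrite disj-zero E i = refl

  dt-fixed : FixedPoint E dt dt
  dt-fixed = all-positive⇒reset has-in-neighbour 0 (λ j → 1≤⇒isPos (dt≥1 j))
    where open Spreading E dt dt≥1 dt

  attractor : (Δ : Config n) → Valid dt Δ → Periodic E dt Δ → (∀ i → Δ i ≡ 0) ⊎ (∀ i → Δ i ≡ dt i)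
  attractor Δ _ (_ , (q , refl) , periodic) with any? (λ u → isPos (Δ u) ≟ᴮ true)
  ... | no none-positive = inj₁ (λ i → isPos≢true⇒≡0 (none-positive ∘ (i ,_)))
  ... | yes (u , u-positive) = inj₂ λ i → begin
    Δ i                                   ≡⟨ sym (iterate-* E dt (suc q) periodic (suc T) i) ⟩
    iterate E dt (suc T * suc q) Δ i      ≡⟨ cong (λ s → iterate E dt s Δ i) late-time ⟩
    iterate E dt (q * suc T + suc T) Δ i  ≡⟨ stays-reset has-in-neighbour T all-positive (q * suc T) i ⟩
    dt i                                  ∎
    where
    open ≡-Reasoning
    open Spreading E dt dt≥1 Δ

    eventually : Σ ℕ λ T → ∀ j → Positive T j
    eventually = eventually-all-positive strong (proj₂ (has-in-neighbour v)) dt≥2 u-positive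

    T : ℕ
    T = proj₁ eventually

    all-positive : ∀ j → Positive T j
    all-positive = proj₂ eventually

    late-time : suc T * suc q ≡ q * suc T + suc T
    late-time = trans (*-comm (suc T) (suc q)) (+-comm (suc T) (q * suc T))
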